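{- Let $n\ge 0$ and $q\ge 1$. Define $\psi:\{0,1\}^n\to\{0,1\}^{n+q+1}$ by $\psi(w)=v\,0\,0\,1^{k+q}$ if $w=v\,0\,1^k$ for some binary word $v$ and some $k\ge 0$, and $\psi(w)=1^{n+q+1}$ if $w$ contains no $0$. Let $\mathcal{W}^q_m$ denote the set of $q$-decreasing binary words of length $m$. Then $\psi(\mathcal{W}^q_n)$ is exactly the set of $q$-decreasing words of length $n+q+1$ ending with at least $q$ letters $1$.
   Context: For $q\ge 1$, a binary word is called $q$-decreasing if each of its maximal factors (maximal blocks of consecutive letters) of the form $0^a1^b$ with $a>0$ satisfies $q\cdot a>b$. Here $u^k$ denotes $k$ concatenated copies of $u$. -}

module Defs where

open import Data.Nat using (ℕ; zero; suc; _+_; _*_; _<_; _>_)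
open import Data.List using (List; []; _∷_; _++_; replicate; reverse; length)
open import Data.Product using (∃; ∃-syntax; _×_; _,_)
open import Relation.Binary.PropositionalEquality using (_≡_)
open import Relation.Nullary using (¬_)

data Bit : Set where
  𝟘 𝟙 : Bit

Word : Set
Word = List Bit

EndsWith : Bit → Word → Set
EndsWith c u = ∃[ u' ] u ≡ u' ++ (c ∷ [])

StartsWith : Bit → Word → Set
StartsWith c z = ∃[ z' ] z ≡ c ∷ z'

-- w = u 0^a 1^b z where 0^a 1^b (a > 0) is a maximal factor of that form:
-- the 0-block cannot be extended to the left, and the factor cannot be
-- extended to the right (by a 1, or by a 0 when b = 0).
MaximalFactor : Word → ℕ → ℕ → Set
MaximalFactor w a b =
  ∃[ u ] ∃[ z ] (w ≡ u ++ (replicate a 𝟘 ++ replicate b 𝟙) ++ z)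
    × a > 0
    × ¬ EndsWith 𝟘 u
    × ¬ StartsWith 𝟙 z
    × (b ≡ 0 → ¬ StartsWith 𝟘 z)

QDecreasing : ℕ → Word → Set
QDecreasing q w = ∀ a b → MaximalFactor w a b → b < q * a

-- the map ψ: if w = v 0 1^k then ψ(w) = v 0 0 1^(k+q); if w = 1^n then ψ(w) = 1^(n+q+1).
-- Implemented by scanning the reversed word for its last 0 (k counts trailing 1s).
ψ-go : ℕ → ℕ → Word → Word
ψ-go q k [] = replicate (suc (k + q)) 𝟙
ψ-go q k (𝟙 ∷ r) = ψ-go q (suc k) r
ψ-go q k (𝟘 ∷ r) = reverse r ++ (𝟘 ∷ 𝟘 ∷ replicate (k + q) 𝟙)

ψ : ℕ → Word → Word
ψ q w = ψ-go q 0 (reverse w)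

-- Every word is either 1^n or v 0^a 1^k with a > 0 and v not ending in 0, and then
-- ψ(v 0^a 1^k) = v 0^(a+1) 1^(k+q).  The maximal factors of v 0^a 1^k are the last block
-- 0^a 1^k and factors that do not depend on a > 0 and k.  As k < qa iff k + q < q(a+1),
-- ψ preserves q-decreasingness; conversely a q-decreasing v 0^a 1^k ending in 1^q has
-- k ≥ q, so a ≥ 2 (a = 1 would give k < q) and the word is ψ(v 0^(a-1) 1^(k-q)).
module Submission where

open import Defs
open import Data.Nat using (ℕ; zero; suc; _+_; _*_; _<_; _≥_; _>_; s≤s; z≤n)
open import Data.Nat.Properties
  using (+-suc; +-comm; +-assoc; +-identityʳ; *-suc; *-identityʳ;
         +-monoʳ-<; +-cancelˡ-<; +-cancelʳ-≡; m+n≮n)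
open import Data.List using (List; []; _∷_; _++_; _∷ʳ_; replicate; reverse; length)
open import Data.List.Properties
  using (∷-injective; ++-assoc; ++-identityʳ; length-++; length-replicate; length-reverse;
         reverse-++; unfold-reverse; reverse-involutive)
open import Data.Product using (∃-syntax; _×_; _,_; proj₁; proj₂)
open import Data.Sum using (_⊎_; inj₁; inj₂; [_,_])
open import Data.Empty using (⊥; ⊥-elim)
open import Relation.Nullary using (¬_)
open import Relation.Binary.PropositionalEquality
  using (_≡_; refl; sym; trans; cong; cong₂; subst; subst₂; module ≡-Reasoning)
open import Function.Base using (_∘_)
open import Function.Bundles using (_⇔_; mk⇔; Equivalence)

open ≡-Reasoning

module _ {A : Set} where

  replicate-+ : ∀ m n (x : A) → replicate (m + n) x ≡ replicate m x ++ replicate n x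
  replicate-+ zero    n x = refl
  replicate-+ (suc m) n x = cong (x ∷_) (replicate-+ m n x)

  replicate-++-∷ : ∀ n (x : A) r → replicate n x ++ x ∷ r ≡ x ∷ replicate n x ++ r
  replicate-++-∷ zero    x r = refl
  replicate-++-∷ (suc n) x r = cong (x ∷_) (replicate-++-∷ n x r)

  ++-replicate-∷ : ∀ v n (x : A) r → (v ++ replicate n x) ++ x ∷ r ≡ v ++ x ∷ replicate n x ++ r
  ++-replicate-∷ v n x r = trans (++-assoc v _ _) (cong (v ++_) (replicate-++-∷ n x r))

  reverse-replicate : ∀ n (x : A) → reverse (replicate n x) ≡ replicate n x
  reverse-replicate zero    x = refl
  reverse-replicate (suc n) x = begin
    reverse (x ∷ replicate n x)        ≡⟨ unfold-reverse x (replicate n x) ⟩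
    reverse (replicate n x) ∷ʳ x       ≡⟨ cong (_∷ʳ x) (reverse-replicate n x) ⟩
    replicate n x ++ x ∷ []            ≡⟨ replicate-++-∷ n x [] ⟩
    x ∷ replicate n x ++ []            ≡⟨ cong (x ∷_) (++-identityʳ _) ⟩
    x ∷ replicate n x                  ∎

  ++-split : ∀ (xs ys us zs : List A) → xs ++ ys ≡ us ++ zs →
    (∃[ m ] us ≡ xs ++ m × ys ≡ m ++ zs) ⊎
    (∃[ y ] ∃[ m ] xs ≡ us ++ y ∷ m × zs ≡ y ∷ m ++ ys)
  ++-split []       ys us       zs eq = inj₁ (us , refl , eq)
  ++-split (x ∷ xs) ys []       zs eq = inj₂ (x , xs , refl , sym eq)
  ++-split (x ∷ xs) ys (u ∷ us) zs eq with ∷-injective eq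
  ... | refl , eq′ with ++-split xs ys us zs eq′
  ...   | inj₁ (m , p , q)     = inj₁ (m , cong (x ∷_) p , q)
  ...   | inj₂ (y , m , p , q) = inj₂ (y , m , cong (x ∷_) p , q)

block : ℕ → ℕ → Word
block a k = replicate a 𝟘 ++ replicate k 𝟙

replicate-𝟙-∌-𝟘 : ∀ k m r → replicate k 𝟙 ≡ m ++ 𝟘 ∷ r → ⊥
replicate-𝟙-∌-𝟘 (suc k) (_ ∷ m) r eq = replicate-𝟙-∌-𝟘 k m r (proj₂ (∷-injective eq))
replicate-𝟙-∌-𝟘 zero    []      r ()
replicate-𝟙-∌-𝟘 zero    (_ ∷ _) r ()
replicate-𝟙-∌-𝟘 (suc k) []      r ()

¬endsWith-[] : ∀ {c} → ¬ EndsWith c []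
¬endsWith-[] ([]    , ())
¬endsWith-[] (_ ∷ _ , ())

endsWith-∷ : ∀ {c x v} → EndsWith c (x ∷ v) → (v ≡ [] × x ≡ c) ⊎ EndsWith c v
endsWith-∷ ([]     , refl) = inj₁ (refl , refl)
endsWith-∷ (_ ∷ u′ , eq)   = inj₂ (u′ , proj₂ (∷-injective eq))

endsWith-++⁺ : ∀ {c} u {m} → EndsWith c m → EndsWith c (u ++ m)
endsWith-++⁺ {c} u (m′ , refl) = u ++ m′ , sym (++-assoc u m′ (c ∷ []))

startsWith-++-block : ∀ {b} m {a a′ k k′} →
  StartsWith b (m ++ block (suc a′) k′) → StartsWith b (m ++ block (suc a) k)
startsWith-++-block []      (_ , refl) = _ , refl
startsWith-++-block (_ ∷ _) (_ , refl) = _ , refl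

block-prefix-endsWith-𝟘 : ∀ a k m r → block a k ≡ m ++ 𝟘 ∷ r → m ≡ [] ⊎ EndsWith 𝟘 m
block-prefix-endsWith-𝟘 zero    k m       r eq = ⊥-elim (replicate-𝟙-∌-𝟘 k m r eq)
block-prefix-endsWith-𝟘 (suc a) k []      r eq = inj₁ refl
block-prefix-endsWith-𝟘 (suc a) k (_ ∷ m) r eq with ∷-injective eq
... | refl , eq′ with block-prefix-endsWith-𝟘 a k m r eq′
...   | inj₁ refl        = inj₂ ([] , refl)
...   | inj₂ (m′ , refl) = inj₂ (𝟘 ∷ m′ , refl)

block-++-injective : ∀ a k c d z → block a k ≡ block c d ++ z →
  ¬ StartsWith 𝟙 z → (d ≡ 0 → ¬ StartsWith 𝟘 z) → a ≡ c × k ≡ d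
block-++-injective zero    k       zero    d       z eq ¬z1 ¬z0 = refl , ones k d eq
  where
  ones : ∀ k d → replicate k 𝟙 ≡ replicate d 𝟙 ++ z → k ≡ d
  ones zero    zero    eq = refl
  ones (suc k) zero    eq = ⊥-elim (¬z1 (replicate k 𝟙 , sym eq))
  ones (suc k) (suc d) eq = cong suc (ones k d (proj₂ (∷-injective eq)))
block-++-injective (suc a) k       zero    zero    z eq ¬z1 ¬z0 = ⊥-elim (¬z0 refl (_ , sym eq))
block-++-injective (suc a) k       (suc c) d       z eq ¬z1 ¬z0 =
  let a≡c , k≡d = block-++-injective a k c d z (proj₂ (∷-injective eq)) ¬z1 ¬z0 in cong suc a≡c , k≡d
block-++-injective zero    zero    (suc c) d       z ()  ¬z1 ¬z0
block-++-injective zero    (suc k) (suc c) d       z eq ¬z1 ¬z0 with () ← proj₁ (∷-injective eq)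
block-++-injective (suc a) k       zero    (suc d) z eq ¬z1 ¬z0 with () ← proj₁ (∷-injective eq)

maximalFactor-last : ∀ {v a k} → a > 0 → ¬ EndsWith 𝟘 v → MaximalFactor (v ++ block a k) a k
maximalFactor-last {v} a>0 ¬v0 =
  v , [] , cong (v ++_) (sym (++-identityʳ _)) , a>0 , ¬v0 , (λ { (_ , ()) }) , (λ _ → λ { (_ , ()) })

-- A maximal factor starting inside v also ends inside v, as v does not end in 0, and
-- what follows it matters only through its first letter, which the last block does not change.
maximalFactor-++-block : ∀ {v a a′ k k′ c d} → ¬ EndsWith 𝟘 v →
  MaximalFactor (v ++ block (suc a) k) c d →
  (c ≡ suc a × d ≡ k) ⊎ MaximalFactor (v ++ block (suc a′) k′) c d
maximalFactor-++-block {v} {a} {a′} {k} {k′} {suc c} {d} ¬v0 (u , z , eq , c>0 , ¬u0 , ¬z1 , ¬z0)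
  with ++-split v (block (suc a) k) u (block (suc c) d ++ z) eq
... | inj₁ (m , refl , blk) with block-prefix-endsWith-𝟘 (suc a) k m _ blk
...   | inj₁ refl = let a≡c , k≡d = block-++-injective (suc a) k (suc c) d z blk ¬z1 ¬z0 in
                    inj₁ (sym a≡c , sym k≡d)
...   | inj₂ m0   = ⊥-elim (¬u0 (endsWith-++⁺ v m0))
maximalFactor-++-block {a = a} {a′} {k} {k′} {suc c} {d} ¬v0 (u , z , eq , c>0 , ¬u0 , ¬z1 , ¬z0)
  | inj₂ (y , m , refl , blk) with ++-split (block (suc c) d) z (y ∷ m) (block (suc a) k) blk
... | inj₁ (m₂ , ym≡ , refl) =
  inj₂ (u , m₂ ++ block (suc a′) k′ , eq′ , c>0 , ¬u0 ,
        ¬z1 ∘ startsWith-++-block m₂ {a} {a′} {k} {k′} ,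
        (λ d≡0 → ¬z0 d≡0 ∘ startsWith-++-block m₂ {a} {a′} {k} {k′}))
  where
  eq′ : (u ++ y ∷ m) ++ block (suc a′) k′ ≡ u ++ (block (suc c) d ++ m₂ ++ block (suc a′) k′)
  eq′ = begin
    (u ++ y ∷ m) ++ block (suc a′) k′                  ≡⟨ ++-assoc u (y ∷ m) _ ⟩
    u ++ (y ∷ m) ++ block (suc a′) k′                  ≡⟨ cong (λ t → u ++ t ++ block (suc a′) k′) ym≡ ⟩
    u ++ (block (suc c) d ++ m₂) ++ block (suc a′) k′  ≡⟨ cong (u ++_) (++-assoc (block (suc c) d) m₂ _) ⟩
    u ++ block (suc c) d ++ m₂ ++ block (suc a′) k′    ∎
... | inj₂ (t , m₃ , blk′ , z≡) with proj₁ (∷-injective z≡)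
...   | refl with block-prefix-endsWith-𝟘 (suc c) d (y ∷ m) m₃ blk′
...     | inj₁ ()
...     | inj₂ ym0 = ⊥-elim (¬v0 (endsWith-++⁺ u ym0))

qDecreasing-replicate-𝟙 : ∀ q n → QDecreasing q (replicate n 𝟙)
qDecreasing-replicate-𝟙 q n (suc a) b (u , _ , eq , _) = ⊥-elim (replicate-𝟙-∌-𝟘 n u _ eq)

qDecreasing-last : ∀ q {v} a k → ¬ EndsWith 𝟘 v → QDecreasing q (v ++ block (suc a) k) → k < q * suc a
qDecreasing-last q a k ¬v0 qd = qd _ _ (maximalFactor-last (s≤s z≤n) ¬v0)

qDecreasing-++-block : ∀ q {v} a k a′ k′ → ¬ EndsWith 𝟘 v →
  QDecreasing q (v ++ block (suc a′) k′) → k < q * suc a → QDecreasing q (v ++ block (suc a) k)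
qDecreasing-++-block q a k a′ k′ ¬v0 qd k<qa c d mf
  with maximalFactor-++-block {a = a} {a′} {k} {k′} ¬v0 mf
... | inj₁ (refl , refl) = k<qa
... | inj₂ mf′           = qd c d mf′

m<n*o⇔m+n<n*[1+o] : ∀ {m n o} → m < n * o ⇔ m + n < n * suc o
m<n*o⇔m+n<n*[1+o] {m} {n} {o} = mk⇔ to from
  where
  to : m < n * o → m + n < n * suc o
  to m<no = subst₂ _<_ (+-comm n m) (sym (*-suc n o)) (+-monoʳ-< n m<no)
  from : m + n < n * suc o → m < n * o
  from lt = +-cancelˡ-< n m (n * o) (subst₂ _<_ (+-comm m n) (*-suc n o) lt)

data Shape : Word → Set where
  ones   : ∀ n → Shape (replicate n 𝟙)
  blocks : ∀ v a k → ¬ EndsWith 𝟘 v → Shape (v ++ block (suc a) k)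

shape : ∀ w → Shape w
shape [] = ones 0
shape (𝟙 ∷ w) with shape w
... | ones n            = ones (suc n)
... | blocks v a k ¬v0  = blocks (𝟙 ∷ v) a k ([ (λ ()) ∘ proj₂ , ¬v0 ] ∘ endsWith-∷)
shape (𝟘 ∷ w) with shape w
... | ones n                = blocks [] 0 n ¬endsWith-[]
... | blocks []      a k _  = blocks [] (suc a) k ¬endsWith-[]
... | blocks (y ∷ v) a k ¬v0 = blocks (𝟘 ∷ y ∷ v) a k ([ (λ ()) ∘ proj₁ , ¬v0 ] ∘ endsWith-∷)

ψ-go-replicate-𝟙 : ∀ q j k r → ψ-go q j (replicate k 𝟙 ++ r) ≡ ψ-go q (k + j) r
ψ-go-replicate-𝟙 q j zero    r = refl
ψ-go-replicate-𝟙 q j (suc k) r = trans (ψ-go-replicate-𝟙 q (suc j) k r) (cong (λ i → ψ-go q i r) (+-suc k j))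

ψ-replicate-𝟙 : ∀ q n → ψ q (replicate n 𝟙) ≡ replicate (suc (n + q)) 𝟙
ψ-replicate-𝟙 q n = begin
  ψ-go q 0 (reverse (replicate n 𝟙))  ≡⟨ cong (ψ-go q 0) (trans (reverse-replicate n 𝟙) (sym (++-identityʳ _))) ⟩
  ψ-go q 0 (replicate n 𝟙 ++ [])      ≡⟨ ψ-go-replicate-𝟙 q 0 n [] ⟩
  replicate (suc (n + 0 + q)) 𝟙       ≡⟨ cong (λ i → replicate (suc (i + q)) 𝟙) (+-identityʳ n) ⟩
  replicate (suc (n + q)) 𝟙           ∎

ψ-++-𝟘-replicate-𝟙 : ∀ q xs k → ψ q (xs ++ 𝟘 ∷ replicate k 𝟙) ≡ xs ++ 𝟘 ∷ 𝟘 ∷ replicate (k + q) 𝟙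
ψ-++-𝟘-replicate-𝟙 q xs k = begin
  ψ-go q 0 (reverse (xs ++ 𝟘 ∷ replicate k 𝟙))   ≡⟨ cong (ψ-go q 0) reversed ⟩
  ψ-go q 0 (replicate k 𝟙 ++ 𝟘 ∷ reverse xs)     ≡⟨ ψ-go-replicate-𝟙 q 0 k _ ⟩
  reverse (reverse xs) ++ 𝟘 ∷ 𝟘 ∷ replicate (k + 0 + q) 𝟙
    ≡⟨ cong₂ (λ ys i → ys ++ 𝟘 ∷ 𝟘 ∷ replicate (i + q) 𝟙) (reverse-involutive xs) (+-identityʳ k) ⟩
  xs ++ 𝟘 ∷ 𝟘 ∷ replicate (k + q) 𝟙            ∎
  where
  reversed : reverse (xs ++ 𝟘 ∷ replicate k 𝟙) ≡ replicate k 𝟙 ++ 𝟘 ∷ reverse xs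
  reversed = begin
    reverse (xs ++ 𝟘 ∷ replicate k 𝟙)           ≡⟨ reverse-++ xs _ ⟩
    reverse (𝟘 ∷ replicate k 𝟙) ++ reverse xs   ≡⟨ cong (_++ reverse xs) (unfold-reverse 𝟘 (replicate k 𝟙)) ⟩
    (reverse (replicate k 𝟙) ∷ʳ 𝟘) ++ reverse xs  ≡⟨ cong ((_++ reverse xs) ∘ (_∷ʳ 𝟘)) (reverse-replicate k 𝟙) ⟩
    (replicate k 𝟙 ∷ʳ 𝟘) ++ reverse xs          ≡⟨ ++-assoc (replicate k 𝟙) _ _ ⟩
    replicate k 𝟙 ++ 𝟘 ∷ reverse xs             ∎

ψ-block : ∀ q v a k → ψ q (v ++ block (suc a) k) ≡ v ++ block (suc (suc a)) (k + q)
ψ-block q v a k = begin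
  ψ q (v ++ block (suc a) k)                               ≡⟨ cong (ψ q) (++-replicate-∷ v a 𝟘 _) ⟨
  ψ q ((v ++ replicate a 𝟘) ++ 𝟘 ∷ replicate k 𝟙)          ≡⟨ ψ-++-𝟘-replicate-𝟙 q _ k ⟩
  (v ++ replicate a 𝟘) ++ 𝟘 ∷ 𝟘 ∷ replicate (k + q) 𝟙      ≡⟨ ++-replicate-∷ v a 𝟘 _ ⟩
  v ++ 𝟘 ∷ replicate a 𝟘 ++ 𝟘 ∷ replicate (k + q) 𝟙        ≡⟨ cong (λ r → v ++ 𝟘 ∷ r) (replicate-++-∷ a 𝟘 _) ⟩
  v ++ block (suc (suc a)) (k + q)                         ∎

length-ψ : ∀ q w → length (ψ q w) ≡ length w + q + 1
length-ψ q w = begin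
  length (ψ-go q 0 (reverse w))     ≡⟨ length-ψ-go 0 (reverse w) ⟩
  suc (length (reverse w) + 0 + q)  ≡⟨ cong (λ l → suc (l + q)) (trans (+-identityʳ _) (length-reverse w)) ⟩
  suc (length w + q)                ≡⟨ +-comm 1 _ ⟩
  length w + q + 1                  ∎
  where
  length-ψ-go : ∀ k r → length (ψ-go q k r) ≡ suc (length r + k + q)
  length-ψ-go k []      = length-replicate (suc (k + q))
  length-ψ-go k (𝟙 ∷ r) = trans (length-ψ-go (suc k) r) (cong (λ l → suc (l + q)) (+-suc (length r) k))
  length-ψ-go k (𝟘 ∷ r) = begin
    length (reverse r ++ 𝟘 ∷ 𝟘 ∷ replicate (k + q) 𝟙)  ≡⟨ length-++ (reverse r) ⟩
    length (reverse r) + suc (suc (length (replicate (k + q) 𝟙)))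
      ≡⟨ cong₂ (λ l i → l + suc (suc i)) (length-reverse r) (length-replicate (k + q)) ⟩
    length r + suc (suc (k + q))                      ≡⟨ trans (+-suc _ _) (cong suc (+-suc _ _)) ⟩
    suc (suc (length r + (k + q)))                    ≡⟨ cong (suc ∘ suc) (+-assoc (length r) k q) ⟨
    suc (suc (length r + k + q))                      ∎

ψ-endsWith-replicate-𝟙 : ∀ q w → ∃[ y ] ψ q w ≡ y ++ replicate q 𝟙
ψ-endsWith-replicate-𝟙 q w = go 0 (reverse w)
  where
  go : ∀ k r → ∃[ y ] ψ-go q k r ≡ y ++ replicate q 𝟙
  go k []      = replicate (suc k) 𝟙 , replicate-+ (suc k) q 𝟙
  go k (𝟙 ∷ r) = go (suc k) r
  go k (𝟘 ∷ r) = reverse r ++ 𝟘 ∷ 𝟘 ∷ replicate k 𝟙 , (begin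
    reverse r ++ 𝟘 ∷ 𝟘 ∷ replicate (k + q) 𝟙               ≡⟨ cong (λ ys → reverse r ++ 𝟘 ∷ 𝟘 ∷ ys) (replicate-+ k q 𝟙) ⟩
    reverse r ++ (𝟘 ∷ 𝟘 ∷ replicate k 𝟙) ++ replicate q 𝟙  ≡⟨ ++-assoc (reverse r) _ _ ⟨
    (reverse r ++ 𝟘 ∷ 𝟘 ∷ replicate k 𝟙) ++ replicate q 𝟙  ∎)

replicate-𝟙-suffix : ∀ xs ys k q → xs ++ 𝟘 ∷ replicate k 𝟙 ≡ ys ++ replicate q 𝟙 → ∃[ j ] k ≡ j + q
replicate-𝟙-suffix xs       []       k q eq = ⊥-elim (replicate-𝟙-∌-𝟘 q xs _ (sym eq))
replicate-𝟙-suffix []       (_ ∷ ys) k q eq = length ys , (begin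
  k                                   ≡⟨ length-replicate k ⟨
  length (replicate k 𝟙)              ≡⟨ cong length (proj₂ (∷-injective eq)) ⟩
  length (ys ++ replicate q 𝟙)        ≡⟨ length-++ ys ⟩
  length ys + length (replicate q 𝟙)  ≡⟨ cong (length ys +_) (length-replicate q) ⟩
  length ys + q                       ∎)
replicate-𝟙-suffix (_ ∷ xs) (_ ∷ ys) k q eq = replicate-𝟙-suffix xs ys k q (proj₂ (∷-injective eq))

qDecreasing-ψ : ∀ q w → QDecreasing q w → QDecreasing q (ψ q w)
qDecreasing-ψ q w qd with shape w
... | ones n =
  subst (QDecreasing q) (sym (ψ-replicate-𝟙 q n)) (qDecreasing-replicate-𝟙 q _)
... | blocks v a k ¬v0 =
  subst (QDecreasing q) (sym (ψ-block q v a k))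
        (qDecreasing-++-block q (suc a) (k + q) a k ¬v0 qd
          (Equivalence.to m<n*o⇔m+n<n*[1+o] (qDecreasing-last q a k ¬v0 qd)))

ψ-preimage-block : ∀ q v a j → ¬ EndsWith 𝟘 v → QDecreasing q (v ++ block (suc a) (j + q)) →
  ∃[ w ] QDecreasing q w × ψ q w ≡ v ++ block (suc a) (j + q)
ψ-preimage-block q v zero    j ¬v0 qd =
  ⊥-elim (m+n≮n j q (subst (j + q <_) (*-identityʳ q) (qDecreasing-last q 0 (j + q) ¬v0 qd)))
ψ-preimage-block q v (suc a) j ¬v0 qd =
  v ++ block (suc a) j ,
  qDecreasing-++-block q a j (suc a) (j + q) ¬v0 qd
    (Equivalence.from m<n*o⇔m+n<n*[1+o] (qDecreasing-last q (suc a) (j + q) ¬v0 qd)) ,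
  ψ-block q v a j

ψ-preimage : ∀ n q x → length x ≡ n + q + 1 → QDecreasing q x → ∃[ y ] x ≡ y ++ replicate q 𝟙 →
  ∃[ w ] QDecreasing q w × ψ q w ≡ x
ψ-preimage n q x lx qd (y , x≡) with shape x
... | ones m = replicate n 𝟙 , qDecreasing-replicate-𝟙 q n , (begin
  ψ q (replicate n 𝟙)        ≡⟨ ψ-replicate-𝟙 q n ⟩
  replicate (suc (n + q)) 𝟙  ≡⟨ cong (λ i → replicate i 𝟙) n+q+1≡m ⟩
  replicate m 𝟙              ∎)
  where
  n+q+1≡m : suc (n + q) ≡ m
  n+q+1≡m = trans (+-comm 1 _) (trans (sym lx) (length-replicate m))
... | blocks v a k ¬v0 with replicate-𝟙-suffix (v ++ replicate a 𝟘) y k q (trans (++-replicate-∷ v a 𝟘 _) x≡)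
...   | j , refl = ψ-preimage-block q v a j ¬v0 qd

proposition2 : (n q : ℕ) → q ≥ 1 → (x : Word) →
    (∃[ w ] (length w ≡ n × QDecreasing q w × ψ q w ≡ x))
    ⇔ (length x ≡ n + q + 1 × QDecreasing q x × ∃[ y ] x ≡ y ++ replicate q 𝟙)
proposition2 n q _ x = mk⇔ image⇒ image⇐
  where
  image⇒ : ∃[ w ] (length w ≡ n × QDecreasing q w × ψ q w ≡ x) →
           length x ≡ n + q + 1 × QDecreasing q x × ∃[ y ] x ≡ y ++ replicate q 𝟙
  image⇒ (w , lw , qd , refl) =
    trans (length-ψ q w) (cong (λ l → l + q + 1) lw) , qDecreasing-ψ q w qd , ψ-endsWith-replicate-𝟙 q w
  image⇐ : length x ≡ n + q + 1 × QDecreasing q x × ∃[ y ] x ≡ y ++ replicate q 𝟙 →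
           ∃[ w ] (length w ≡ n × QDecreasing q w × ψ q w ≡ x)
  image⇐ (lx , qd , suffix) with ψ-preimage n q x lx qd suffix
  ... | w , qdw , ψw≡x =
    w , +-cancelʳ-≡ q _ _ (+-cancelʳ-≡ 1 _ _ lengths) , qdw , ψw≡x
    where
    lengths : length w + q + 1 ≡ n + q + 1
    lengths = trans (sym (length-ψ q w)) (trans (cong length ψw≡x) lx)
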